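{- Let $\mathcal H$ be the complete $3$-uniform hypergraph on a $12$-element vertex set $V$, with each edge (each $3$-subset of $V$) colored by one of three colors $c_1,c_2,c_3$, and suppose $\mathcal H$ contains no $4$ pairwise disjoint edges using at most two colors. If $A\subseteq V$ is an $A$-set, then $V\setminus A$ is a $B$-set.
   Context: A set $A\subseteq V$ with $|A|=6$ is an $A$-set if $A$ contains two disjoint $3$-subsets of the same color (a monochromatic perfect matching of $A$). A set $S\subseteq V$ with $|S|=6$ is a $B$-set if there is one color that is not the color of any $3$-subset of $S$, and no two disjoint $3$-subsets of $S$ have the same color. -}

module Defs where

open import Data.Nat using (ℕ)
open import Data.Fin using (Fin)
open import Data.Fin.Subset using (Subset; _⊆_; _∩_; ∣_∣; ∁; Empty)
open import Data.Product using (Σ; ∃; _×_; _,_)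
open import Data.Sum using (_⊎_)
open import Relation.Binary.PropositionalEquality using (_≡_; _≢_)
open import Relation.Nullary using (¬_)

-- Vertex set V = Fin 12; subsets of V are Subset 12.
V-size : ℕ
V-size = 12

-- A 3-colouring of the edges of the complete 3-uniform hypergraph on V.
-- Colours c₁ c₂ c₃ are Fin 3.  The colouring is a total function on
-- subsets; only its values on 3-subsets are ever used.
Colouring : Set
Colouring = Subset 12 → Fin 3

IsEdge : Subset 12 → Set
IsEdge e = ∣ e ∣ ≡ 3

Disjoint : Subset 12 → Subset 12 → Set
Disjoint x y = Empty (x ∩ y)

InPair : Fin 3 → Fin 3 → Fin 3 → Set
InPair a b k = (k ≡ a) ⊎ (k ≡ b)

HasTwoColour4Matching : Colouring → Set
HasTwoColour4Matching c =
  Σ (Subset 12) λ e₁ → Σ (Subset 12) λ e₂ → Σ (Subset 12) λ e₃ → Σ (Subset 12) λ e₄ →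
    (IsEdge e₁ × IsEdge e₂ × IsEdge e₃ × IsEdge e₄) ×
    (Disjoint e₁ e₂ × Disjoint e₁ e₃ × Disjoint e₁ e₄ ×
     Disjoint e₂ e₃ × Disjoint e₂ e₄ × Disjoint e₃ e₄) ×
    (Σ (Fin 3) λ a → Σ (Fin 3) λ b →
       InPair a b (c e₁) × InPair a b (c e₂) × InPair a b (c e₃) × InPair a b (c e₄))

IsASet : Colouring → Subset 12 → Set
IsASet c A =
  ∣ A ∣ ≡ 6 ×
  (Σ (Subset 12) λ e₁ → Σ (Subset 12) λ e₂ →
     IsEdge e₁ × IsEdge e₂ × e₁ ⊆ A × e₂ ⊆ A × Disjoint e₁ e₂ × c e₁ ≡ c e₂)

IsBSet : Colouring → Subset 12 → Set
IsBSet c S =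
  ∣ S ∣ ≡ 6 ×
  (Σ (Fin 3) λ k → ∀ e → IsEdge e → e ⊆ S → c e ≢ k) ×
  (∀ e₁ e₂ → IsEdge e₁ → IsEdge e₂ → e₁ ⊆ S → e₂ ⊆ S → Disjoint e₁ e₂ → c e₁ ≢ c e₂)

module Submission where

-- Let A be an A-set, witnessed by disjoint edges e₁, e₂ ⊆ A
-- of a common colour a, and put S = ∁ A, which has 12 - 6 = 6 vertices.  Any
-- two disjoint edges f₁, f₂ ⊆ S are disjoint from e₁ and e₂ as well, so
-- e₁, e₂, f₁, f₂ is a perfect matching of V; it uses only the colours a and
-- c f₁ as soon as c f₂ ∈ {a, c f₁}, which the hypothesis forbids.  Hence
--   * no two disjoint edges of S share a colour (take c f₂ = c f₁), and
--   * no edge f ⊆ S has colour a: its complement S ∖ f is again an edge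
--     (6 - 3 = 3 vertices), disjoint from f, so take f₁ = S ∖ f, f₂ = f.

open import Defs
open import Data.Fin.Subset using (Subset; ∁; _∩_; _⊆_; ∣_∣; Empty)
open import Data.Fin.Subset.Properties
  using (x∈p∩q⁻; x∈∁p⇒x∉p; ∣∁p∣≡n∸∣p∣; p∩q⊆p; drop-∷-⊆)
open import Data.Fin using (Fin)
open import Data.Nat using (ℕ; suc; _+_)
open import Data.Nat.Properties using (+-suc; +-cancelʳ-≡)
open import Data.Bool using (true; false)
open import Data.Vec using ([]; _∷_; here)
open import Data.Product using (_,_; proj₂)
open import Data.Empty using (⊥)
open import Data.Sum using (inj₁; inj₂)
open import Relation.Binary.PropositionalEquality using (_≡_; refl; sym; trans; cong)
open import Relation.Nullary using (¬_)

private
  variable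
    n : ℕ

inside-outside-disjoint : {A e f : Subset n} → e ⊆ A → f ⊆ ∁ A → Empty (e ∩ f)
inside-outside-disjoint {e = e} {f} e⊆A f⊆∁A (i , i∈e∩f) =
  let (i∈e , i∈f) = x∈p∩q⁻ e f i∈e∩f in x∈∁p⇒x∉p (f⊆∁A i∈f) (e⊆A i∈e)

relComplement-disjoint : (S f : Subset n) → Empty ((S ∩ ∁ f) ∩ f)
relComplement-disjoint S f (i , i∈S∖f∩f) =
  let (i∈S∖f , i∈f) = x∈p∩q⁻ (S ∩ ∁ f) f i∈S∖f∩f
  in x∈∁p⇒x∉p (proj₂ (x∈p∩q⁻ S (∁ f) i∈S∖f)) i∈f

∣relComplement∣ : (S f : Subset n) → f ⊆ S → ∣ S ∩ ∁ f ∣ + ∣ f ∣ ≡ ∣ S ∣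
∣relComplement∣ []          []          _   = refl
∣relComplement∣ (true ∷ S)  (true ∷ f)  f⊆S =
  trans (+-suc _ _) (cong suc (∣relComplement∣ S f (drop-∷-⊆ f⊆S)))
∣relComplement∣ (true ∷ S)  (false ∷ f) f⊆S = cong suc (∣relComplement∣ S f (drop-∷-⊆ f⊆S))
∣relComplement∣ (false ∷ S) (true ∷ f)  f⊆S with () ← f⊆S here
∣relComplement∣ (false ∷ S) (false ∷ f) f⊆S = ∣relComplement∣ S f (drop-∷-⊆ f⊆S)

∣relComplement∣≡ : (S f : Subset n) (k m : ℕ) →
  f ⊆ S → ∣ S ∣ ≡ k + m → ∣ f ∣ ≡ m → ∣ S ∩ ∁ f ∣ ≡ k
∣relComplement∣≡ S f k m f⊆S ∣S∣ ∣f∣ =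
  +-cancelʳ-≡ m _ k (trans (cong (∣ S ∩ ∁ f ∣ +_) (sym ∣f∣))
                           (trans (∣relComplement∣ S f f⊆S) ∣S∣))

crossMatching : (c : Colouring) (A e₁ e₂ f₁ f₂ : Subset 12) →
  IsEdge e₁ → IsEdge e₂ → IsEdge f₁ → IsEdge f₂ →
  e₁ ⊆ A → e₂ ⊆ A → f₁ ⊆ ∁ A → f₂ ⊆ ∁ A →
  Disjoint e₁ e₂ → Disjoint f₁ f₂ → (a b : Fin 3) →
  InPair a b (c e₁) → InPair a b (c e₂) → InPair a b (c f₁) → InPair a b (c f₂) →
  HasTwoColour4Matching c
crossMatching c A e₁ e₂ f₁ f₂ E₁ E₂ F₁ F₂ e₁⊆A e₂⊆A f₁⊆∁A f₂⊆∁A e₁e₂ f₁f₂ a b ce₁ ce₂ cf₁ cf₂ =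
  e₁ , e₂ , f₁ , f₂ , (E₁ , E₂ , F₁ , F₂) ,
  ( e₁e₂
  , inside-outside-disjoint e₁⊆A f₁⊆∁A , inside-outside-disjoint e₁⊆A f₂⊆∁A
  , inside-outside-disjoint e₂⊆A f₁⊆∁A , inside-outside-disjoint e₂⊆A f₂⊆∁A
  , f₁f₂ ) ,
  (a , b , ce₁ , ce₂ , cf₁ , cf₂)

mainTheorem5 : (c : Colouring) → ¬ HasTwoColour4Matching c →
    (A : Subset 12) → IsASet c A → IsBSet c (∁ A)
mainTheorem5 c noMatching A (∣A∣ , e₁ , e₂ , E₁ , E₂ , e₁⊆A , e₂⊆A , e₁e₂ , ce₁≡ce₂) =
  ∣∁A∣ , (c e₁ , colourMissing) , rainbowPairs
  where
  ∣∁A∣ : ∣ ∁ A ∣ ≡ 6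
  ∣∁A∣ rewrite ∣∁p∣≡n∸∣p∣ A | ∣A∣ = refl

  forbidden : ∀ f₁ f₂ → IsEdge f₁ → IsEdge f₂ → f₁ ⊆ ∁ A → f₂ ⊆ ∁ A →
    Disjoint f₁ f₂ → InPair (c e₁) (c f₁) (c f₂) → ⊥
  forbidden f₁ f₂ F₁ F₂ f₁⊆∁A f₂⊆∁A f₁f₂ cf₂ =
    noMatching (crossMatching c A e₁ e₂ f₁ f₂ E₁ E₂ F₁ F₂ e₁⊆A e₂⊆A f₁⊆∁A f₂⊆∁A
                  e₁e₂ f₁f₂ (c e₁) (c f₁) (inj₁ refl) (inj₁ (sym ce₁≡ce₂)) (inj₂ refl) cf₂)

  rainbowPairs : ∀ f₁ f₂ → IsEdge f₁ → IsEdge f₂ → f₁ ⊆ ∁ A → f₂ ⊆ ∁ A →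
    Disjoint f₁ f₂ → ¬ (c f₁ ≡ c f₂)
  rainbowPairs f₁ f₂ F₁ F₂ f₁⊆∁A f₂⊆∁A f₁f₂ cf₁≡cf₂ =
    forbidden f₁ f₂ F₁ F₂ f₁⊆∁A f₂⊆∁A f₁f₂ (inj₂ (sym cf₁≡cf₂))

  -- An edge f ⊆ ∁ A of colour c e₁ pairs with the edge f′ = ∁ A ∖ f,
  -- which has 6 - 3 = 3 vertices.
  colourMissing : ∀ f → IsEdge f → f ⊆ ∁ A → ¬ (c f ≡ c e₁)
  colourMissing f F f⊆∁A cf≡ce₁ =
    forbidden f′ f F′ F (p∩q⊆p (∁ A) (∁ f)) f⊆∁A
      (relComplement-disjoint (∁ A) f) (inj₁ cf≡ce₁)
    where
    f′ : Subset 12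
    f′ = ∁ A ∩ ∁ f
    F′ : IsEdge f′
    F′ = ∣relComplement∣≡ (∁ A) f 3 3 f⊆∁A ∣∁A∣ F
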